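{- For all positive integers $m,p,r$ with $p\mid m$, $\mathrm{APS}(m,p,2r)=\mathrm{APS}(m,1,2r)$.
   Context: $[n]=\{1,\dots,n\}$, $\xi=e^{2\pi i/m}$; $\xi^a(x)$ denotes $\xi^a\cdot x$ for $0\le a\le m-1$, $x\in[n]$; $\mathbb{I}_n^m=\bigcup_{a=0}^{m-1}\{\xi^a(1),\dots,\xi^a(n)\}$, totally ordered by $\xi^a(x)\prec\xi^b(y)$ iff $a>b$, or $a=b$ and $x>y$. $\mathbb{Z}_m\wr S_n$ is the group of bijections $w$ of $\mathbb{I}_n^m$ with $w(\xi^i x)=\xi^i w(x)$ for $x\in[n]$, all $i$, written $w(n)\cdots w(1)$. $\operatorname{Pin}(w)=\{w(i):2\le i\le n-1,\ w(i+1)\prec w(i)\succ w(i-1)\}$. For $w$ with $w(i)=\xi^{e_i}(x_i)$, $e_i\in\{0,\dots,m-1\}$, $\varepsilon_w=\sum_i e_i$. For $p\mid m$, $G(m,p,n)=\{w\in\mathbb{Z}_m\wr S_n:\varepsilon_w\equiv0\pmod p\}$. $\mathrm{APS}(m,p,n)$ is the set of all $P\subseteq\mathbb{I}_n^m$ with $P=\operatorname{Pin}(w)$ for some $w\in G(m,p,n)$. -}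

module Defs where

open import Level using (0ℓ)
open import Data.Nat as ℕ using (ℕ; suc; _+_; _*_)
open import Data.Nat.Divisibility using (_∣_)
open import Data.Nat.ListAction using (sum)
open import Data.Fin as Fin using (Fin; toℕ)
open import Data.Fin.Permutation using (Permutation′; _⟨$⟩ʳ_)
open import Data.Product using (Σ; ∃; _×_; _,_; proj₁; proj₂)
open import Data.Sum using (_⊎_)
open import Data.List using (List; map; allFin)
open import Relation.Binary.PropositionalEquality using (_≡_)
open import Relation.Unary using (Pred)
open import Function.Bundles using (_⇔_)

-- I_n^m : the element ξ^a(x) is the pair (a , x), with a ∈ {0,…,m-1}
-- (as Fin m) and x ∈ [n] (as Fin n, x-1 stored 0-based).
I : ℕ → ℕ → Set
I m n = Fin m × Fin n

_≺_ : ∀ {m n} → I m n → I m n → Set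
(a , x) ≺ (b , y) = (toℕ b ℕ.< toℕ a) ⊎ (a ≡ b × toℕ y ℕ.< toℕ x)

-- An element of Z_m ≀ S_n is determined by its values on [n]:
-- w(i) = ξ^{e_i}(π(i)) with π a permutation of [n] and e_i ∈ {0,…,m-1}.
record Wreath (m n : ℕ) : Set where
  constructor wr
  field
    perm : Permutation′ n
    expo : Fin n → Fin m

open Wreath public

apply : ∀ {m n} → Wreath m n → Fin n → I m n
apply w i = expo w i , perm w ⟨$⟩ʳ i

ε : ∀ {m n} → Wreath m n → ℕ
ε {n = n} w = sum (map (λ i → toℕ (expo w i)) (allFin n))

InG : (m p n : ℕ) → Wreath m n → Set
InG m p n w = p ∣ ε w

Pin : ∀ {m n} → Wreath m n → Pred (I m n) 0ℓ
Pin {m} {n} w z =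
  Σ (Fin n) λ i → Σ (Fin n) λ j → Σ (Fin n) λ k →
    (toℕ j ≡ suc (toℕ i)) × (toℕ k ≡ suc (toℕ j)) ×
    (z ≡ apply w j) × (apply w k ≺ apply w j) × (apply w i ≺ apply w j)

_≐_ : ∀ {m n} → Pred (I m n) 0ℓ → Pred (I m n) 0ℓ → Set
P ≐ Q = ∀ z → P z ⇔ Q z

InAPS : (m p n : ℕ) → Pred (I m n) 0ℓ → Set
InAPS m p n P = Σ (Wreath m n) λ w → InG m p n w × (P ≐ Pin w)

{-# OPTIONS --safe #-}
-- Pin(w) depends only on the word w(1) ⋯ w(n) compared by ≺.  In a word of even length
-- some letter can be deleted without changing the peaks, and a letter that does not occur
-- can always be inserted somewhere without changing them.  Deleting such a letter ξ^a(x)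
-- and re-inserting x with a colour chosen to make the colour sum divisible by m gives
-- w′ ∈ G(m,m,n) ⊆ G(m,p,n) with Pin(w′) = Pin(w).
-- For the deletion, scan from the first ascent a ≺ b: with the next two letters c, d,
-- delete b if b ≺ c, delete c if d ≺ c ≺ b, and otherwise restart from the ascent c ≺ d.
-- Even length guarantees that b is last when the letters run out, so it can be deleted;
-- in odd length a final peak b ≻ c may be forced.
module Submission where

open import Defs
open import Level using (0ℓ; _⊔_)
import Data.Nat.Properties as ℕP
open import Algebra.Properties.CommutativeMonoid.Sum ℕP.+-0-commutativeMonoid
  using (sum-syntax; sum-remove; sum-cong-≗)
open import Algebra.Properties.CommutativeSemigroup ℕP.+-commutativeSemigroup using (x∙yz≈z∙yx)
open import Data.Empty using (⊥-elim)
open import Data.Fin as Fin using (Fin; zero; suc; toℕ; punchIn; punchOut)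
open import Data.Fin.Permutation as Perm using (Permutation; _⟨$⟩ʳ_; _∘ₚ_)
open import Data.Fin.Properties using (<-strictTotalOrder; punchInᵢ≢i; punchIn-injective; punchIn-punchOut)
import Data.List as List
open import Data.List.Properties using (map-tabulate)
open import Data.Nat using (ℕ; zero; suc; _+_; _*_; _<_)
open import Data.Nat.DivMod using (_divMod_; DivMod)
open import Data.Nat.Divisibility using (_∣_; ∣-refl; ∣-trans; 1∣_; ∣1⇒≡1; ∣m+n∣m⇒∣n; m∣m*n; n∣m*n)
import Data.Nat.ListAction as ListAction
open import Data.Product using (Σ; ∃; _×_; _,_; proj₁; proj₂)
open import Data.Product.Relation.Binary.Lex.Strict using (×-strictTotalOrder)
open import Data.Sum using (_⊎_; inj₁; inj₂)
open import Data.Vec using (Vec; []; _∷_; tabulate; lookup; removeAt; insertAt)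
open import Data.Vec.Properties using (insertAt-lookup; insertAt-punchIn; lookup∘tabulate; tabulate∘lookup; tabulate-cong)
open import Data.Vec.Relation.Unary.All using (All; _∷_)
import Data.Vec.Relation.Unary.All.Properties as All
import Data.Vec.Relation.Unary.Unique.Setoid.Properties as Unique
open import Function.Base using (_∘_)
open import Function.Bundles using (_⇔_; mk⇔; Equivalence; Injection)
open import Function.Construct.Composition using (_⇔-∘_)
open import Function.Construct.Identity using (⇔-id)
open import Function.Construct.Symmetry using (⇔-sym)
open import Function.Properties.Inverse using (↔⇒↣)
open import Relation.Binary.Bundles using (StrictTotalOrder)
open import Relation.Binary.Definitions using (tri<; tri≈; tri>)
import Relation.Binary.Construct.Flip.EqAndOrd as Flip
open import Relation.Binary.PropositionalEquality using (_≡_; refl; sym; trans; cong; cong₂; subst; module ≡-Reasoning)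
open import Relation.Nullary using (Dec; yes; no)
open import Relation.Nullary.Decidable using (dec-yes)
open import Relation.Unary using (Pred)

2∣2+n⇒2∣n : ∀ {n} → 2 ∣ 2 + n → 2 ∣ n
2∣2+n⇒2∣n 2∣2+n = ∣m+n∣m⇒∣n 2∣2+n ∣-refl

module Peaks {o ℓ₁ ℓ₂} (O : StrictTotalOrder o ℓ₁ ℓ₂) where

  open StrictTotalOrder O renaming (Carrier to V; _<_ to _⊏_; trans to ⊏-trans; asym to ⊏-asym)
  open import Data.Vec.Relation.Unary.Unique.Setoid Eq.setoid public using (Unique; _∷_)

  data Peak : ∀ {n} → Vec V n → Pred V (o ⊔ ℓ₂) where
    here  : ∀ {n a b c} {xs : Vec V n} → c ⊏ b → a ⊏ b → Peak (a ∷ b ∷ c ∷ xs) b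
    there : ∀ {n a y} {xs : Vec V n} → Peak xs y → Peak (a ∷ xs) y

  PeakAt : ∀ {n} → (Fin n → V) → Pred V (o ⊔ ℓ₂)
  PeakAt {n} f y = Σ (Fin n) λ i → Σ (Fin n) λ j → Σ (Fin n) λ k →
    (toℕ j ≡ suc (toℕ i)) × (toℕ k ≡ suc (toℕ j)) ×
    (y ≡ f j) × (f k ⊏ f j) × (f i ⊏ f j)

  PeakAt⇒Peak : ∀ {n} (f : Fin n → V) {y} → PeakAt f y → Peak (tabulate f) y
  PeakAt⇒Peak f (zero , suc zero , suc (suc zero) , _ , _ , refl , c⊏b , a⊏b) = here c⊏b a⊏b
  PeakAt⇒Peak f (suc i , suc j , suc k , j≡1+i , k≡1+j , y≡b , c⊏b , a⊏b) =
    there (PeakAt⇒Peak (f ∘ suc) (i , j , k , ℕP.suc-injective j≡1+i , ℕP.suc-injective k≡1+j , y≡b , c⊏b , a⊏b))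
  PeakAt⇒Peak f (_ , zero , _ , () , _)
  PeakAt⇒Peak f (zero , suc (suc _) , _ , () , _)
  PeakAt⇒Peak f (_ , suc _ , zero , _ , () , _)
  PeakAt⇒Peak f (zero , suc zero , suc zero , _ , () , _)
  PeakAt⇒Peak f (zero , suc zero , suc (suc (suc _)) , _ , () , _)

  Peak⇒PeakAt : ∀ {n} (f : Fin n → V) {y} → Peak (tabulate f) y → PeakAt f y
  Peak⇒PeakAt {suc (suc (suc _))} f (here c⊏b a⊏b) = zero , suc zero , suc (suc zero) , refl , refl , refl , c⊏b , a⊏b
  Peak⇒PeakAt {suc _} f (there p) with Peak⇒PeakAt (f ∘ suc) p
  ... | i , j , k , j≡1+i , k≡1+j , y≡b , c⊏b , a⊏b =
    suc i , suc j , suc k , cong suc j≡1+i , cong suc k≡1+j , y≡b , c⊏b , a⊏b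

  PeakAt⇔Peak : ∀ {n} (f : Fin n → V) y → PeakAt f y ⇔ Peak (tabulate f) y
  PeakAt⇔Peak f y = mk⇔ (PeakAt⇒Peak f) (Peak⇒PeakAt f)

  infix 4 _≈ᴾ_
  _≈ᴾ_ : ∀ {m n} → Vec V m → Vec V n → Set (o ⊔ ℓ₂)
  xs ≈ᴾ ys = ∀ y → Peak xs y ⇔ Peak ys y

  ≈ᴾ-reflexive : ∀ {n} {xs ys : Vec V n} → xs ≡ ys → xs ≈ᴾ ys
  ≈ᴾ-reflexive refl y = ⇔-id _

  ≈ᴾ-sym : ∀ {m n} {xs : Vec V m} {ys : Vec V n} → xs ≈ᴾ ys → ys ≈ᴾ xs
  ≈ᴾ-sym eq y = ⇔-sym (eq y)

  ≈ᴾ-trans : ∀ {m n k} {xs : Vec V m} {ys : Vec V n} {zs : Vec V k} → xs ≈ᴾ ys → ys ≈ᴾ zs → xs ≈ᴾ zs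
  ≈ᴾ-trans eq eq′ y = eq′ y ⇔-∘ eq y

  ⊏-connected : ∀ {x y} → x ≉ y → x ⊏ y ⊎ y ⊏ x
  ⊏-connected {x} {y} x≉y with compare x y
  ... | tri< x⊏y _ _ = inj₁ x⊏y
  ... | tri≈ _ x≈y _ = ⊥-elim (x≉y x≈y)
  ... | tri> _ _ y⊏x = inj₂ y⊏x

  ≈ᴾ-drop-descent : ∀ {n a b} {xs : Vec V n} → b ⊏ a → (a ∷ b ∷ xs) ≈ᴾ (b ∷ xs)
  ≈ᴾ-drop-descent b⊏a y = mk⇔ drop there
    where
    drop : Peak (_ ∷ _ ∷ _) y → Peak (_ ∷ _) y
    drop (here _ a⊏b) = ⊥-elim (⊏-asym a⊏b b⊏a)
    drop (there p) = p

  ≈ᴾ-drop-ascent : ∀ {n a b c} {xs : Vec V n} → b ⊏ c → (a ∷ b ∷ c ∷ xs) ≈ᴾ (b ∷ c ∷ xs)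
  ≈ᴾ-drop-ascent b⊏c y = mk⇔ drop there
    where
    drop : Peak (_ ∷ _ ∷ _ ∷ _) y → Peak (_ ∷ _ ∷ _) y
    drop (here c⊏b _) = ⊥-elim (⊏-asym b⊏c c⊏b)
    drop (there p) = p

  ≈ᴾ-head : ∀ {n a b c} {xs : Vec V n} → a ⊏ c → b ⊏ c → (a ∷ c ∷ xs) ≈ᴾ (b ∷ c ∷ xs)
  ≈ᴾ-head a⊏c b⊏c y = mk⇔ (swap b⊏c) (swap a⊏c)
    where
    swap : ∀ {a b} → b ⊏ _ → Peak (a ∷ _ ∷ _) y → Peak (b ∷ _ ∷ _) y
    swap b⊏c (here d⊏c _) = here d⊏c b⊏c
    swap _ (there p) = there p

  ≈ᴾ-below-peak : ∀ {m n a b c d} {xs : Vec V m} {ys : Vec V n} → a ⊏ b → c ⊏ b → d ⊏ b →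
                  (c ∷ xs) ≈ᴾ (d ∷ ys) → (a ∷ b ∷ c ∷ xs) ≈ᴾ (a ∷ b ∷ d ∷ ys)
  ≈ᴾ-below-peak {b = b} a⊏b c⊏b d⊏b eq y = mk⇔ (extend d⊏b (tails y)) (extend c⊏b (≈ᴾ-sym tails y))
    where
    tails : (b ∷ _ ∷ _) ≈ᴾ (b ∷ _ ∷ _)
    tails = ≈ᴾ-trans (≈ᴾ-drop-descent c⊏b) (≈ᴾ-trans eq (≈ᴾ-sym (≈ᴾ-drop-descent d⊏b)))
    extend : ∀ {m n c d} {xs : Vec V m} {ys : Vec V n} → d ⊏ b →
             Peak (b ∷ c ∷ xs) y ⇔ Peak (b ∷ d ∷ ys) y → Peak (_ ∷ b ∷ c ∷ xs) y → Peak (_ ∷ b ∷ d ∷ ys) y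
    extend d⊏b _ (here _ _) = here d⊏b a⊏b
    extend _ eq (there p) = there (Equivalence.to eq p)

  ∃-removeAt-≈ᴾ-after-ascent : ∀ {n a b} (xs : Vec V n) → 2 ∣ n → a ⊏ b → Unique (b ∷ xs) →
                              ∃ λ s → (a ∷ removeAt (b ∷ xs) s) ≈ᴾ (a ∷ b ∷ xs)
  ∃-removeAt-≈ᴾ-after-ascent [] _ _ _ = zero , λ y → mk⇔ (λ { (there ()) }) (λ { (there (there ())) })
  ∃-removeAt-≈ᴾ-after-ascent (c ∷ []) 2∣1 _ _ with () ← ∣1⇒≡1 2∣1
  ∃-removeAt-≈ᴾ-after-ascent (c ∷ d ∷ xs) 2∣2+n a⊏b ((b≉c ∷ _) ∷ (c≉d ∷ _) ∷ unique)
    with ⊏-connected b≉c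
  ... | inj₁ b⊏c = zero , ≈ᴾ-trans (≈ᴾ-head (⊏-trans a⊏b b⊏c) b⊏c) (≈ᴾ-sym (≈ᴾ-drop-ascent b⊏c))
  ... | inj₂ c⊏b with ⊏-connected c≉d
  ...   | inj₂ d⊏c = suc zero , ≈ᴾ-below-peak a⊏b (⊏-trans d⊏c c⊏b) c⊏b (≈ᴾ-sym (≈ᴾ-drop-descent d⊏c))
  ...   | inj₁ c⊏d with ∃-removeAt-≈ᴾ-after-ascent xs (2∣2+n⇒2∣n 2∣2+n) c⊏d unique
  ...     | s , eq = suc (suc s) , ≈ᴾ-below-peak a⊏b c⊏b c⊏b eq

  ∃-removeAt-≈ᴾ : ∀ {n} (xs : Vec V (suc n)) → 2 ∣ suc n → Unique xs → ∃ λ s → removeAt xs s ≈ᴾ xs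
  ∃-removeAt-≈ᴾ (a ∷ []) 2∣1 _ with () ← ∣1⇒≡1 2∣1
  ∃-removeAt-≈ᴾ (a ∷ b ∷ xs) 2∣2+n ((a≉b ∷ _) ∷ unique) with ⊏-connected a≉b
  ... | inj₂ b⊏a = zero , ≈ᴾ-sym (≈ᴾ-drop-descent b⊏a)
  ... | inj₁ a⊏b with ∃-removeAt-≈ᴾ-after-ascent xs (2∣2+n⇒2∣n 2∣2+n) a⊏b unique
  ...   | s , eq = suc s , eq

  ∃-insertAt-≈ᴾ : ∀ {n} z (xs : Vec V n) → Unique xs → All (z ≉_) xs → ∃ λ t → insertAt xs t z ≈ᴾ xs
  ∃-insertAt-≈ᴾ z [] _ _ = zero , λ y → mk⇔ (λ { (there ()) }) (λ ())
  ∃-insertAt-≈ᴾ z (a ∷ []) _ _ = zero , λ y → mk⇔ (λ { (there (there ())) }) (λ { (there ()) })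
  ∃-insertAt-≈ᴾ z (a ∷ b ∷ xs) ((a≉b ∷ _) ∷ unique) (z≉a ∷ fresh) with ⊏-connected a≉b | ⊏-connected z≉a
  ... | inj₁ a⊏b | _ = zero , ≈ᴾ-drop-ascent a⊏b
  ... | inj₂ b⊏a | inj₂ a⊏z = zero , ≈ᴾ-drop-descent a⊏z
  ... | inj₂ b⊏a | inj₁ z⊏a with ∃-insertAt-≈ᴾ z (b ∷ xs) unique fresh
  ...   | zero , eq = suc zero , ≈ᴾ-trans (≈ᴾ-drop-descent z⊏a) (≈ᴾ-trans eq (≈ᴾ-sym (≈ᴾ-drop-descent b⊏a)))
  ...   | suc t , eq = suc (suc t) , ≈ᴾ-trans (≈ᴾ-drop-descent b⊏a) (≈ᴾ-trans eq (≈ᴾ-sym (≈ᴾ-drop-descent b⊏a)))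

-- Its order is _≺_ on the nose, so Pin w is definitionally PeakAt (apply w).
≺-strictTotalOrder : (m n : ℕ) → StrictTotalOrder 0ℓ 0ℓ 0ℓ
≺-strictTotalOrder m n =
  ×-strictTotalOrder (Flip.strictTotalOrder (<-strictTotalOrder m)) (Flip.strictTotalOrder (<-strictTotalOrder n))

sum-tabulate : ∀ {n} (f : Fin n → ℕ) → ListAction.sum (List.tabulate f) ≡ ∑[ i < n ] f i
sum-tabulate {zero} f = refl
sum-tabulate {suc n} f = cong (f zero +_) (sum-tabulate (f ∘ suc))

ε≡∑ : ∀ {m n} (w : Wreath m n) → ε w ≡ ∑[ i < n ] toℕ (expo w i)
ε≡∑ w = trans (cong ListAction.sum (map-tabulate (λ i → i) (toℕ ∘ expo w))) (sum-tabulate (toℕ ∘ expo w))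

∃-residue-cancelling : ∀ m c → ∃ λ (e : Fin (suc m)) → suc m ∣ toℕ e + c
∃-residue-cancelling m c = remainder , ∣m+n∣m⇒∣n (subst (suc m ∣_) 1+m*c≡ (m∣m*n c)) (n∣m*n quotient)
  where
  open DivMod (m * c divMod suc m)
  1+m*c≡ : suc m * c ≡ quotient * suc m + (toℕ remainder + c)
  1+m*c≡ = trans (cong (c +_) property) (x∙yz≈z∙yx c (toℕ remainder) (quotient * suc m))

insert-self : ∀ {m n} i j (π : Permutation m n) → Perm.insert i j π ⟨$⟩ʳ i ≡ j
insert-self i j π rewrite proj₂ (dec-yes (i Fin.≟ i) refl) = refl

module _ {m n : ℕ} where

  open Peaks (≺-strictTotalOrder m n)

  letters : Wreath m n → Vec (I m n) n
  letters w = tabulate (apply w)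

  ≈ᴾ⇒Pin≐ : ∀ (w w′ : Wreath m n) → letters w ≈ᴾ letters w′ → Pin w ≐ Pin w′
  ≈ᴾ⇒Pin≐ w w′ eq z = ⇔-sym (PeakAt⇔Peak (apply w′) z) ⇔-∘ (eq z ⇔-∘ PeakAt⇔Peak (apply w) z)

  tabulate-apply-unique : (w : Wreath m n) {k : ℕ} {f : Fin k → Fin n} →
                          (∀ {i j} → f i ≡ f j → i ≡ j) → Unique (tabulate (apply w ∘ f))
  tabulate-apply-unique w f-injective =
    Unique.tabulate⁺ (StrictTotalOrder.Eq.setoid (≺-strictTotalOrder m n))
      (f-injective ∘ Injection.injective (↔⇒↣ (perm w)) ∘ proj₂)

removeAt-tabulate : ∀ {a} {A : Set a} {n} (f : Fin (suc n) → A) (i : Fin (suc n)) →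
                    removeAt (tabulate f) i ≡ tabulate (f ∘ punchIn i)
removeAt-tabulate f zero = refl
removeAt-tabulate {n = suc n} f (suc i) = cong (f zero ∷_) (removeAt-tabulate (f ∘ suc) i)

module _ {m n : ℕ} (w : Wreath m (suc n)) where

  open StrictTotalOrder (≺-strictTotalOrder m (suc n)) using (_≉_)

  lettersWithout : Fin (suc n) → Vec (I m (suc n)) n
  lettersWithout s = tabulate (apply w ∘ punchIn s)

  relocatedLetters : Fin (suc n) → Fin (suc n) → Fin m → Vec (I m (suc n)) (suc n)
  relocatedLetters s t e = insertAt (lettersWithout s) t (e , perm w ⟨$⟩ʳ s)

  -- moves the letter at position s to position t and recolours it with e
  relocate : Fin (suc n) → Fin (suc n) → Fin m → Wreath m (suc n)
  relocate s t e = wr (Perm.insert t s Perm.id ∘ₚ perm w) (proj₁ ∘ lookup (relocatedLetters s t e))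

  lettersWithout-fresh : ∀ s e → All ((e , perm w ⟨$⟩ʳ s) ≉_) (lettersWithout s)
  lettersWithout-fresh s e = All.tabulate⁺ λ k same →
    punchInᵢ≢i s k (sym (Injection.injective (↔⇒↣ (perm w)) (proj₂ same)))

  relocatedLetters-punchIn : ∀ s t e k → lookup (relocatedLetters s t e) (punchIn t k) ≡ apply w (punchIn s k)
  relocatedLetters-punchIn s t e k = trans (insertAt-punchIn (lettersWithout s) t _ k) (lookup∘tabulate _ k)

  letters-relocate : ∀ s t e → letters (relocate s t e) ≡ relocatedLetters s t e
  letters-relocate s t e = trans (tabulate-cong (λ i → apply-relocate i (t Fin.≟ i))) (tabulate∘lookup _)
    where
    apply-relocate : ∀ i → Dec (t ≡ i) → apply (relocate s t e) i ≡ lookup (relocatedLetters s t e) i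
    apply-relocate _ (yes refl) = trans
      (cong₂ _,_ (cong proj₁ (insertAt-lookup (lettersWithout s) t _)) (cong (perm w ⟨$⟩ʳ_) (insert-self t s Perm.id)))
      (sym (insertAt-lookup (lettersWithout s) t _))
    apply-relocate _ (no t≢i) with k ← punchOut t≢i | refl ← punchIn-punchOut t≢i = trans
      (cong₂ _,_ (cong proj₁ (relocatedLetters-punchIn s t e k)) (cong (perm w ⟨$⟩ʳ_) (Perm.insert-punchIn t s Perm.id k)))
      (sym (relocatedLetters-punchIn s t e k))

  ε-relocate : ∀ s t e → ε (relocate s t e) ≡ toℕ e + ∑[ k < n ] toℕ (expo w (punchIn s k))
  ε-relocate s t e = begin
    ε (relocate s t e)                       ≡⟨ ε≡∑ (relocate s t e) ⟩
    ∑[ i < suc n ] colour i                  ≡⟨ sum-remove colour ⟩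
    colour t + ∑[ k < n ] colour (punchIn t k)
      ≡⟨ cong₂ _+_ (cong (toℕ ∘ proj₁) (insertAt-lookup (lettersWithout s) t _))
                   (sum-cong-≗ (cong (toℕ ∘ proj₁) ∘ relocatedLetters-punchIn s t e)) ⟩
    toℕ e + ∑[ k < n ] toℕ (expo w (punchIn s k)) ∎
    where
    open ≡-Reasoning
    colour : Fin (suc n) → ℕ
    colour i = toℕ (proj₁ (lookup (relocatedLetters s t e) i))

InAPS-≐ : ∀ {m p n} {P Q : Pred (I m n) 0ℓ} → P ≐ Q → InAPS m p n Q → InAPS m p n P
InAPS-≐ P≐Q (w , w∈G , Q≐Pin-w) = w , w∈G , λ z → Q≐Pin-w z ⇔-∘ P≐Q z

InAPS-∣ : ∀ {m p q n} {P : Pred (I m n) 0ℓ} → p ∣ q → InAPS m q n P → InAPS m p n P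
InAPS-∣ p∣q (w , q∣ε , P≐Pin-w) = w , ∣-trans p∣q q∣ε , P≐Pin-w

module _ {m n : ℕ} where

  open Peaks (≺-strictTotalOrder (suc m) (suc n))

  Pin∈APS[m,m] : (w : Wreath (suc m) (suc n)) → 2 ∣ suc n → InAPS (suc m) (suc m) (suc n) (Pin w)
  Pin∈APS[m,m] w 2∣1+n
    with s , removeAt≈ᴾ ← ∃-removeAt-≈ᴾ (letters w) 2∣1+n (tabulate-apply-unique w (λ i≡j → i≡j))
    with e , m∣ε ← ∃-residue-cancelling m (∑[ k < n ] toℕ (expo w (punchIn s k)))
    with t , insertAt≈ᴾ ← ∃-insertAt-≈ᴾ (e , perm w ⟨$⟩ʳ s) (lettersWithout w s)
                             (tabulate-apply-unique w (punchIn-injective s _ _)) (lettersWithout-fresh w s e)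
    = relocate w s t e
    , subst (suc m ∣_) (sym (ε-relocate w s t e)) m∣ε
    , ≈ᴾ⇒Pin≐ w (relocate w s t e) (≈ᴾ-trans (≈ᴾ-sym removeAt≈ᴾ)
                 (≈ᴾ-trans (≈ᴾ-reflexive (removeAt-tabulate (apply w) s))
                 (≈ᴾ-trans (≈ᴾ-sym insertAt≈ᴾ) (≈ᴾ-reflexive (sym (letters-relocate w s t e))))))

mainTheorem15 : (m p r : ℕ) → 0 < m → 0 < p → 0 < r → p ∣ m →
    (P : Pred (I m (2 * r)) 0ℓ) → InAPS m p (2 * r) P ⇔ InAPS m 1 (2 * r) P
mainTheorem15 (suc m) p (suc r) _ _ _ p∣m _ = mk⇔ (InAPS-∣ (1∣ p)) λ (w , _ , P≐Pin-w) →
  InAPS-≐ P≐Pin-w (InAPS-∣ p∣m (Pin∈APS[m,m] w (m∣m*n (suc r))))
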